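{- Subject reduction fails for $\vdash_1$. Let $a,b,c\in\mathcal A$ be pairwise distinct and $y,z,x\in\mathcal V$ distinct. Then $(\lambda x^0.x^0x^0)(y^0z^0)\rhd_\beta(y^0z^0)(y^0z^0)$ and $(\lambda x^0.x^0x^0)(y^0z^0):\langle y^0:b\to((a\to c)\sqcap a),\ z^0:b\vdash_1 c\rangle$, but it is not the case that $(y^0z^0)(y^0z^0):\langle y^0:b\to((a\to c)\sqcap a),\ z^0:b\vdash_1 c\rangle$.
   Context: Terms ($\lambda I^{\mathbb N}$-calculus). Fix a denumerably infinite set $\mathcal V$ of variable names. Indexed variables are $x^n$ with $x\in\mathcal V$, $n\in\mathbb N$. The set $\mathcal M$ of terms, free variables $FV$ and degree $d$: $x^n\in\mathcal M$, $FV(x^n)=\{x^n\}$, $d(x^n)=n$; if $M,N\in\mathcal M$ are joinable ($M\diamond N$: for all $x$, $x^m\in FV(M)$ and $x^n\in FV(N)$ imply $m=n$) then $MN\in\mathcal M$, $FV(MN)=FV(M)\cup FV(N)$, $d(MN)=\min(d(M),d(N))$; if $M\in\mathcal M$ and $x^n\in FV(M)$ then $\lambda x^n.M\in\mathcal M$, $FV(\lambda x^n.M)=FV(M)\setminus\{x^n\}$, $d(\lambda x^n.M)=d(M)$. Terms are taken modulo $\alpha$-conversion; substitution is defined only when all involved terms are pairwise joinable. $\rhd_\beta$ is the least compatible relation containing $(\lambda x^n.M)N\rhd_\beta M[x^n:=N]$ when $d(N)=n$. $M^+$ replaces every variable index $n$ in $M$ by $n+1$. Types. Fix denumerably infinite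 sets $\mathcal A$ and $\mathcal E$. $\mathcal T::=a\mid\mathcal T\to\mathcal T\mid\mathcal T\sqcap\mathcal T\mid e\,\mathcal T$ ($a\in\mathcal A$, $e\in\mathcal E$), quotiented by commutativity, associativity, idempotence of $\sqcap$ and $e(U_1\sqcap U_2)=eU_1\sqcap eU_2$. Degree: $d(a)=0$, $d(U\to T)=\min(d(U),d(T))$, $d(eU)=d(U)+1$, $d(U\sqcap V)=\min(d(U),d(V))$. Good types: atoms; $eU$ if $U$ good; $U\to T$ if $U,T$ good and $d(U)\ge d(T)$; $U\sqcap V$ if $U,V$ good and $d(U)=d(V)$. Environments: finite sets $(x_i^{n_i}:U_i)_i$ with distinct $x_i^{n_i}$; $\Gamma,x^m:U$ adds a declaration for $x^m\notin dom(\Gamma)$; $\Gamma_1\sqcap\Gamma_2$ intersects types of common variables and keeps the rest; $e\Gamma=(x_i^{n_i+1}:eU_i)_i$; $\Gamma_1\diamond\Gamma_2$ iff any $x^m\in dom(\Gamma_1)$, $x^n\in dom(\Gamma_2)$ have $m=n$. Typing rules of $\vdash_1$ (all types in $\mathcal T$): (ax) $x^n:\langle(x^n:T)\vdash_1 T\rangle$ if $T$ good and $d(T)=n$; ($\to_I$) from $M:\langle\Gamma,x^n:U\vdash_1 T\rangle$ infer $\lambda x^n.M:\langle\Gamma\vdash_1 U\to T\rangle$; ($\to_E$) from $M_1:\langle\Gamma_1\vdash_1 U\to T\rangle$, $M_2:\langle\Gamma_2\vdash_1 U\rangle$, $\Gamma_1\diamond\Gamma_2$ infer $M_1M_2:\langle\Gamma_1\sqcap\Gamma_2\vdash_1T\rangle$;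 ($\sqcap$) from $M:\langle\Gamma_1\vdash_1U_1\rangle$, $M:\langle\Gamma_2\vdash_1U_2\rangle$ infer $M:\langle\Gamma_1\sqcap\Gamma_2\vdash_1U_1\sqcap U_2\rangle$; (exp) from $M:\langle\Gamma\vdash_1U\rangle$ infer $M^+:\langle e\Gamma\vdash_1 eU\rangle$. -}

module Defs where

open import Data.Nat using (ℕ; zero; suc; _⊔_) renaming (_⊓_ to min; _≟_ to _≟ℕ_)
open import Data.Product using (_×_; _,_)
open import Data.List using (List; []; _∷_; _++_; filter)
open import Data.List.Membership.Propositional using (_∈_; _∉_)
open import Data.Maybe using (Maybe; just; nothing) renaming (map to mapMaybe)
open import Data.Maybe.Relation.Binary.Pointwise using (Pointwise)
open import Data.Maybe.Relation.Unary.Any using () renaming (Any to MAny)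
open import Data.Unit using (⊤)
open import Relation.Binary.PropositionalEquality using (_≡_; _≢_)
open import Relation.Nullary using (¬_; yes; no; Dec)
open import Relation.Nullary.Decidable using (⌊_⌋; ¬?)
open import Data.Bool using (Bool; true; false; if_then_else_)
open import Data.Product.Properties using (≡-dec)

-- Variables, terms (raw syntax; α-conversion handled by the Barendregt
-- side condition on substitution)

Name : Set
Name = ℕ

-- indexed variable x^n
Var : Set
Var = ℕ × ℕ

_≟v_ : (u v : Var) → Dec (u ≡ v)
_≟v_ = ≡-dec _≟ℕ_ _≟ℕ_

data Term : Set where
  var : Name → ℕ → Term
  _·_ : Term → Term → Term
  lam : Name → ℕ → Term → Term

infixl 7 _·_

FV : Term → List Var
FV (var x n) = (x , n) ∷ []
FV (M · N)   = FV M ++ FV N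
FV (lam x n M) = filter (λ v → ¬? (v ≟v (x , n))) (FV M)

BV : Term → List Var
BV (var x n) = []
BV (M · N) = BV M ++ BV N
BV (lam x n M) = (x , n) ∷ BV M

dT : Term → ℕ
dT (var x n) = n
dT (M · N) = min (dT M) (dT N)
dT (lam x n M) = dT M

Joinable : Term → Term → Set
Joinable M N = ∀ x m n → (x , m) ∈ FV M → (x , n) ∈ FV N → m ≡ n

data WfTerm : Term → Set where
  wf-var : ∀ x n → WfTerm (var x n)
  wf-app : ∀ {M N} → WfTerm M → WfTerm N → Joinable M N → WfTerm (M · N)
  wf-lam : ∀ {x n M} → WfTerm M → (x , n) ∈ FV M → WfTerm (lam x n M)

_⁺ : Term → Term
var x n ⁺ = var x (suc n)
(M · N) ⁺ = (M ⁺) · (N ⁺)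
lam x n M ⁺ = lam x (suc n) (M ⁺)

-- substitution M[v := N] (naive; only used under the side condition
-- that no bound variable of M is free in N, so it is capture-avoiding)
_[_≔_] : Term → Var → Term → Term
var y m [ v ≔ N ] with (y , m) ≟v v
... | yes _ = N
... | no  _ = var y m
(M₁ · M₂) [ v ≔ N ] = (M₁ [ v ≔ N ]) · (M₂ [ v ≔ N ])
lam y m M [ v ≔ N ] with (y , m) ≟v v
... | yes _ = lam y m M
... | no  _ = lam y m (M [ v ≔ N ])

data _▹β_ : Term → Term → Set where
  β-rule : ∀ {x n M N} →
           WfTerm (lam x n M · N) →
           Joinable M N →
           (∀ w → w ∈ BV M → w ∉ FV N) →
           dT N ≡ n →
           (lam x n M · N) ▹β (M [ (x , n) ≔ N ])
  ▹-appL : ∀ {M M' N} → M ▹β M' → (M · N) ▹β (M' · N)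
  ▹-appR : ∀ {M N N'} → N ▹β N' → (M · N) ▹β (M · N')
  ▹-lam  : ∀ {x n M M'} → M ▹β M' → lam x n M ▹β lam x n M'

infix 4 _▹β_

Atom : Set
Atom = ℕ

EVar : Set
EVar = ℕ

data Ty : Set where
  atom : Atom → Ty
  _⇒_  : Ty → Ty → Ty
  _∧_  : Ty → Ty → Ty
  ex   : EVar → Ty → Ty

infixr 6 _⇒_
infixr 7 _∧_

data _≈_ : Ty → Ty → Set where
  ≈-refl  : ∀ {U} → U ≈ U
  ≈-sym   : ∀ {U V} → U ≈ V → V ≈ U
  ≈-trans : ∀ {U V W} → U ≈ V → V ≈ W → U ≈ W
  ≈-⇒     : ∀ {U U' T T'} → U ≈ U' → T ≈ T' → (U ⇒ T) ≈ (U' ⇒ T')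
  ≈-∧     : ∀ {U U' V V'} → U ≈ U' → V ≈ V' → (U ∧ V) ≈ (U' ∧ V')
  ≈-ex    : ∀ {e U U'} → U ≈ U' → ex e U ≈ ex e U'
  ∧-comm  : ∀ {U V} → (U ∧ V) ≈ (V ∧ U)
  ∧-assoc : ∀ {U V W} → ((U ∧ V) ∧ W) ≈ (U ∧ (V ∧ W))
  ∧-idem  : ∀ {U} → (U ∧ U) ≈ U
  ex-∧    : ∀ {e U V} → ex e (U ∧ V) ≈ (ex e U ∧ ex e V)

infix 4 _≈_

dTy : Ty → ℕ
dTy (atom a) = 0
dTy (U ⇒ T) = min (dTy U) (dTy T)
dTy (U ∧ V) = min (dTy U) (dTy V)
dTy (ex e U) = suc (dTy U)

data _≤ℕ_ : ℕ → ℕ → Set where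
  z≤ : ∀ {n} → zero ≤ℕ n
  s≤ : ∀ {m n} → m ≤ℕ n → suc m ≤ℕ suc n

data Good : Ty → Set where
  good-atom : ∀ a → Good (atom a)
  good-ex   : ∀ {e U} → Good U → Good (ex e U)
  good-⇒    : ∀ {U T} → Good U → Good T → dTy T ≤ℕ dTy U → Good (U ⇒ T)
  good-∧    : ∀ {U V} → Good U → Good V → dTy U ≡ dTy V → Good (U ∧ V)

Env : Set
Env = Var → Maybe Ty

_≈E_ : Env → Env → Set
Γ ≈E Δ = ∀ v → Pointwise _≈_ (Γ v) (Δ v)

∅ : Env
∅ _ = nothing

single : Var → Ty → Env
single v T w with w ≟v v
... | yes _ = just T
... | no  _ = nothing

-- Γ , x^n : U   (used only when x^n ∉ dom Γ)
_,,_∶_ : Env → Var → Ty → Env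
(Γ ,, v ∶ U) w with w ≟v v
... | yes _ = just U
... | no  _ = Γ w

meetM : Maybe Ty → Maybe Ty → Maybe Ty
meetM (just U) (just V) = just (U ∧ V)
meetM (just U) nothing  = just U
meetM nothing  m        = m

_⊓E_ : Env → Env → Env
(Γ₁ ⊓E Γ₂) v = meetM (Γ₁ v) (Γ₂ v)

exE : EVar → Env → Env
exE e Γ (x , zero)  = nothing
exE e Γ (x , suc n) = mapMaybe (ex e) (Γ (x , n))

InDom : Var → Env → Set
InDom v Γ = MAny (λ _ → ⊤) (Γ v)

_⋄E_ : Env → Env → Set
Γ₁ ⋄E Γ₂ = ∀ x m n → InDom (x , m) Γ₁ → InDom (x , n) Γ₂ → m ≡ n

-- The typing system ⊢₁ ; judgements are taken modulo the type
-- equations (rule conv realises the quotient).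

data _∶⟨_⊢₁_⟩ : Term → Env → Ty → Set where
  ax   : ∀ {x n T} → Good T → dTy T ≡ n →
         var x n ∶⟨ single (x , n) T ⊢₁ T ⟩
  ⇒I   : ∀ {Γ x n U T M} → Γ (x , n) ≡ nothing →
         M ∶⟨ Γ ,, (x , n) ∶ U ⊢₁ T ⟩ →
         lam x n M ∶⟨ Γ ⊢₁ U ⇒ T ⟩
  ⇒E   : ∀ {Γ₁ Γ₂ U T M₁ M₂} →
         M₁ ∶⟨ Γ₁ ⊢₁ U ⇒ T ⟩ → M₂ ∶⟨ Γ₂ ⊢₁ U ⟩ → Γ₁ ⋄E Γ₂ →
         (M₁ · M₂) ∶⟨ Γ₁ ⊓E Γ₂ ⊢₁ T ⟩
  ⊓I   : ∀ {Γ₁ Γ₂ U₁ U₂ M} →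
         M ∶⟨ Γ₁ ⊢₁ U₁ ⟩ → M ∶⟨ Γ₂ ⊢₁ U₂ ⟩ →
         M ∶⟨ Γ₁ ⊓E Γ₂ ⊢₁ U₁ ∧ U₂ ⟩
  exp  : ∀ {Γ U M e} → M ∶⟨ Γ ⊢₁ U ⟩ → (M ⁺) ∶⟨ exE e Γ ⊢₁ ex e U ⟩
  conv : ∀ {Γ Γ' U U' M} → Γ ≈E Γ' → U ≈ U' →
         M ∶⟨ Γ ⊢₁ U ⟩ → M ∶⟨ Γ' ⊢₁ U' ⟩

module Submission where

-- Untypability of the contractum is proved with two predicates on types
-- that are invariant under the type equations _≈_:
--   * AtomicPart T: some ⊓-component of T (seen through expansion
--     variables) is an atom; in particular no arrow has one;
--   * ArrowsToAtomic T: every arrow ⊓-component of T has a codomain with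
--     an atomic part; y's declared type b → ((a → c) ⊓ a) is such a type.
-- In an environment where all declared types are ArrowsToAtomic, every type
-- of y⁰ is ArrowsToAtomic, hence every type of y⁰N has an atomic part, hence
-- y⁰N is never of arrow type and (y⁰N)N' is untypable.  The rule (exp) never
-- applies to these terms since their head variable has index 0.

open import Defs
open import Data.Nat using (ℕ; suc; _⊓_)
open import Data.Nat.Properties using (⊓-idem)
open import Data.Product using (_×_; _,_; proj₁; proj₂)
open import Data.Product.Function.NonDependent.Propositional using (_×-⇔_)
open import Data.Product.Algebra using (×-comm; ×-assoc)
open import Data.Sum using (_⊎_; inj₁; inj₂; [_,_])
open import Data.Sum.Function.Propositional using (_⊎-⇔_)
open import Data.Sum.Algebra using (⊎-comm; ⊎-assoc)
open import Data.Unit using (⊤; tt)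
open import Data.Empty using (⊥; ⊥-elim)
open import Data.Maybe using (just; nothing)
open import Data.Maybe.Relation.Unary.All using (All; just; nothing)
open import Data.Maybe.Relation.Binary.Pointwise using (Pointwise; just; nothing)
open import Data.List.Membership.Propositional using (_∈_)
open import Data.List.Relation.Unary.Any using (here)
open import Data.List.Membership.Propositional.Properties using (∈-++⁻; ∈-filter⁻)
open import Function using (id)
open import Function.Bundles using (_⇔_; mk⇔; Equivalence)
open import Function.Properties.Inverse using (↔⇒⇔)
import Function.Properties.Equivalence as ⇔
open import Relation.Binary.PropositionalEquality using (_≡_; _≢_; refl; sym; trans; cong₂; subst)
open import Relation.Nullary using (¬_; yes; no)

UniformIndex : ℕ → Term → Set
UniformIndex n (var x m)   = m ≡ n
UniformIndex n (M · N)     = UniformIndex n M × UniformIndex n N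
UniformIndex n (lam x m M) = UniformIndex n M

FV-uniform : ∀ {n} M {x m} → UniformIndex n M → (x , m) ∈ FV M → m ≡ n
FV-uniform (var x m)   m≡n (here refl) = m≡n
FV-uniform (M · N) (uM , uN) x∈ with ∈-++⁻ (FV M) x∈
... | inj₁ x∈M = FV-uniform M uM x∈M
... | inj₂ x∈N = FV-uniform N uN x∈N
FV-uniform (lam y k M) uM x∈ = FV-uniform M uM (proj₁ (∈-filter⁻ _ {xs = FV M} x∈))

uniform-joinable : ∀ {n} M N → UniformIndex n M → UniformIndex n N → Joinable M N
uniform-joinable M N uM uN x m k x∈M x∈N = trans (FV-uniform M uM x∈M) (sym (FV-uniform N uN x∈N))

uniform-degree : ∀ {n} M → UniformIndex n M → dT M ≡ n
uniform-degree (var x m)   m≡n       = m≡n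
uniform-degree {n} (M · N) (uM , uN) = trans (cong₂ _⊓_ (uniform-degree M uM) (uniform-degree N uN)) (⊓-idem n)
uniform-degree (lam x m M) uM        = uniform-degree M uM

subst-var-self : ∀ x n N → var x n [ (x , n) ≔ N ] ≡ N
subst-var-self x n N with (x , n) ≟v (x , n)
... | yes _  = refl
... | no x≢x = ⊥-elim (x≢x refl)

-- The index of the head variable; (exp) raises it, so it cannot produce a
-- term whose head has index 0.
headIndex : Term → ℕ
headIndex (var x n)   = n
headIndex (M · N)     = headIndex M
headIndex (lam x n M) = n

headIndex-⁺ : ∀ M → headIndex (M ⁺) ≡ suc (headIndex M)
headIndex-⁺ (var x n)   = refl
headIndex-⁺ (M · N)     = headIndex-⁺ M
headIndex-⁺ (lam x n M) = refl

⁺-headIndex≢0 : ∀ M N → M ⁺ ≡ N → headIndex N ≢ 0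
⁺-headIndex≢0 M N refl h0 with trans (sym (headIndex-⁺ M)) h0
... | ()

single-self : ∀ v T → single v T v ≡ just T
single-self v T with v ≟v v
... | yes _  = refl
... | no v≢v = ⊥-elim (v≢v refl)

single-index : ∀ {u m v n T} → InDom (u , m) (single (v , n) T) → m ≡ n
single-index {u} {m} {v} {n} p with (u , m) ≟v (v , n)
... | yes refl = refl
... | no _ with p
...   | ()

single-joinable : ∀ {u v n T T'} → single (u , n) T ⋄E single (v , n) T'
single-joinable x m k p q = trans (single-index p) (sym (single-index q))

∅-joinable : ∀ {Γ} → ∅ ⋄E Γ
∅-joinable x m k ()

single-⊓ : ∀ v U V → (single v U ⊓E single v V) ≈E (∅ ,, v ∶ (U ∧ V))
single-⊓ v U V w with w ≟v v
... | yes _ = just ≈-refl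
... | no  _ = nothing

AtomicPart : Ty → Set
AtomicPart (atom _) = ⊤
AtomicPart (_ ⇒ _)  = ⊥
AtomicPart (U ∧ V)  = AtomicPart U ⊎ AtomicPart V
AtomicPart (ex _ U) = AtomicPart U

ArrowsToAtomic : Ty → Set
ArrowsToAtomic (atom _) = ⊤
ArrowsToAtomic (_ ⇒ T)  = AtomicPart T
ArrowsToAtomic (U ∧ V)  = ArrowsToAtomic U × ArrowsToAtomic V
ArrowsToAtomic (ex _ U) = ArrowsToAtomic U

⊎-idem : ∀ {A : Set} → (A ⊎ A) ⇔ A
⊎-idem = mk⇔ [ id , id ] inj₁

×-idem : ∀ {A : Set} → (A × A) ⇔ A
×-idem = mk⇔ proj₁ (λ p → p , p)

AtomicPart-≈ : ∀ {U V} → U ≈ V → AtomicPart U ⇔ AtomicPart V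
AtomicPart-≈ ≈-refl        = ⇔.refl
AtomicPart-≈ (≈-sym p)     = ⇔.sym (AtomicPart-≈ p)
AtomicPart-≈ (≈-trans p q) = ⇔.trans (AtomicPart-≈ p) (AtomicPart-≈ q)
AtomicPart-≈ (≈-⇒ _ _)     = ⇔.refl
AtomicPart-≈ (≈-∧ p q)     = AtomicPart-≈ p ⊎-⇔ AtomicPart-≈ q
AtomicPart-≈ (≈-ex p)      = AtomicPart-≈ p
AtomicPart-≈ ∧-comm        = ↔⇒⇔ (⊎-comm _ _)
AtomicPart-≈ ∧-assoc       = ↔⇒⇔ (⊎-assoc _ _ _ _)
AtomicPart-≈ ∧-idem        = ⊎-idem
AtomicPart-≈ ex-∧          = ⇔.refl

ArrowsToAtomic-≈ : ∀ {U V} → U ≈ V → ArrowsToAtomic U ⇔ ArrowsToAtomic V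
ArrowsToAtomic-≈ ≈-refl        = ⇔.refl
ArrowsToAtomic-≈ (≈-sym p)     = ⇔.sym (ArrowsToAtomic-≈ p)
ArrowsToAtomic-≈ (≈-trans p q) = ⇔.trans (ArrowsToAtomic-≈ p) (ArrowsToAtomic-≈ q)
ArrowsToAtomic-≈ (≈-⇒ _ q)     = AtomicPart-≈ q
ArrowsToAtomic-≈ (≈-∧ p q)     = ArrowsToAtomic-≈ p ×-⇔ ArrowsToAtomic-≈ q
ArrowsToAtomic-≈ (≈-ex p)      = ArrowsToAtomic-≈ p
ArrowsToAtomic-≈ ∧-comm        = ↔⇒⇔ (×-comm _ _)
ArrowsToAtomic-≈ ∧-assoc       = ↔⇒⇔ (×-assoc _ _ _ _)
ArrowsToAtomic-≈ ∧-idem        = ×-idem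
ArrowsToAtomic-≈ ex-∧          = ⇔.refl

EnvAll : (Ty → Set) → Env → Set
EnvAll P Γ = ∀ v → All P (Γ v)

module _ {P : Ty → Set} where

  EnvAll-single : ∀ {v T} → P T → EnvAll P (single v T)
  EnvAll-single {v} pT w with w ≟v v
  ... | yes _ = just pT
  ... | no  _ = nothing

  module _ (split : ∀ {U V} → P (U ∧ V) → P U × P V)
           (join : ∀ {U V} → P U → P V → P (U ∧ V)) where

    EnvAll-⊓⁻ : ∀ {Γ₁ Γ₂} → EnvAll P (Γ₁ ⊓E Γ₂) → EnvAll P Γ₁ × EnvAll P Γ₂
    EnvAll-⊓⁻ {Γ₁} {Γ₂} h = (λ v → proj₁ (meet⁻ (Γ₁ v) (Γ₂ v) (h v)))
                          , (λ v → proj₂ (meet⁻ (Γ₁ v) (Γ₂ v) (h v)))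
      where
      meet⁻ : ∀ m₁ m₂ → All P (meetM m₁ m₂) → All P m₁ × All P m₂
      meet⁻ (just U) (just V) (just pUV) = let (pU , pV) = split pUV in just pU , just pV
      meet⁻ (just U) nothing  pU         = pU , nothing
      meet⁻ nothing  m₂       pm₂        = nothing , pm₂

    EnvAll-⊓⁺ : ∀ {Γ₁ Γ₂} → EnvAll P Γ₁ → EnvAll P Γ₂ → EnvAll P (Γ₁ ⊓E Γ₂)
    EnvAll-⊓⁺ {Γ₁} {Γ₂} h₁ h₂ v = meet⁺ (h₁ v) (h₂ v)
      where
      meet⁺ : ∀ {m₁ m₂} → All P m₁ → All P m₂ → All P (meetM m₁ m₂)
      meet⁺ (just pU) (just pV) = just (join pU pV)
      meet⁺ (just pU) nothing   = just pU
      meet⁺ nothing   pm₂       = pm₂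

  EnvAll-≈ : (∀ {U V} → U ≈ V → P V → P U) → ∀ {Γ Γ'} → Γ ≈E Γ' → EnvAll P Γ' → EnvAll P Γ
  EnvAll-≈ resp Γ≈Γ' h v = pointwise (Γ≈Γ' v) (h v)
    where
    pointwise : ∀ {m m'} → Pointwise _≈_ m m' → All P m' → All P m
    pointwise (just U≈V) (just pV) = just (resp U≈V pV)
    pointwise nothing    nothing   = nothing

TameEnv : Env → Set
TameEnv = EnvAll ArrowsToAtomic

tame-⊓⁻ : ∀ {Γ₁ Γ₂} → TameEnv (Γ₁ ⊓E Γ₂) → TameEnv Γ₁ × TameEnv Γ₂
tame-⊓⁻ = EnvAll-⊓⁻ id _,_

tame-⊓⁺ : ∀ {Γ₁ Γ₂} → TameEnv Γ₁ → TameEnv Γ₂ → TameEnv (Γ₁ ⊓E Γ₂)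
tame-⊓⁺ = EnvAll-⊓⁺ id _,_

tame-≈ : ∀ {Γ Γ'} → Γ ≈E Γ' → TameEnv Γ' → TameEnv Γ
tame-≈ = EnvAll-≈ (λ U≈V → Equivalence.from (ArrowsToAtomic-≈ U≈V))

var-ArrowsToAtomic : ∀ {y M Δ T} → M ∶⟨ Δ ⊢₁ T ⟩ → M ≡ var y 0 → TameEnv Δ → ArrowsToAtomic T
var-ArrowsToAtomic {y} {T = T} (ax _ _) refl tame
  with single (y , 0) T (y , 0) | single-self (y , 0) T | tame (y , 0)
... | _ | refl | just pT = pT
var-ArrowsToAtomic (⊓I D₁ D₂) eq tame =
  let (tame₁ , tame₂) = tame-⊓⁻ tame in var-ArrowsToAtomic D₁ eq tame₁ , var-ArrowsToAtomic D₂ eq tame₂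
var-ArrowsToAtomic (exp {M = M} _) eq _ = ⊥-elim (⁺-headIndex≢0 M _ eq refl)
var-ArrowsToAtomic (conv Γ≈Γ' U≈U' D) eq tame =
  Equivalence.to (ArrowsToAtomic-≈ U≈U') (var-ArrowsToAtomic D eq (tame-≈ Γ≈Γ' tame))

app-AtomicPart : ∀ {y N M Δ T} → M ∶⟨ Δ ⊢₁ T ⟩ → M ≡ var y 0 · N → TameEnv Δ → AtomicPart T
app-AtomicPart (⇒E D₁ _ _) refl tame = var-ArrowsToAtomic D₁ refl (proj₁ (tame-⊓⁻ tame))
app-AtomicPart (⊓I D₁ _) eq tame = inj₁ (app-AtomicPart D₁ eq (proj₁ (tame-⊓⁻ tame)))
app-AtomicPart (exp {M = M} _) eq _ = ⊥-elim (⁺-headIndex≢0 M _ eq refl)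
app-AtomicPart (conv Γ≈Γ' U≈U' D) eq tame =
  Equivalence.to (AtomicPart-≈ U≈U') (app-AtomicPart D eq (tame-≈ Γ≈Γ' tame))

app-app-untypable : ∀ {y N N' M Δ T} → M ∶⟨ Δ ⊢₁ T ⟩ → M ≡ (var y 0 · N) · N' → TameEnv Δ → ⊥
app-app-untypable (⇒E D₁ _ _) refl tame = app-AtomicPart D₁ refl (proj₁ (tame-⊓⁻ tame))
app-app-untypable (⊓I D₁ _) eq tame = app-app-untypable D₁ eq (proj₁ (tame-⊓⁻ tame))
app-app-untypable (exp {M = M} _) eq _ = ⊥-elim (⁺-headIndex≢0 M _ eq refl)
app-app-untypable (conv Γ≈Γ' _ D) eq tame = app-app-untypable D eq (tame-≈ Γ≈Γ' tame)

self-app-β : ∀ x n N → WfTerm N → UniformIndex n N →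
             (lam x n (var x n · var x n) · N) ▹β (N · N)
self-app-β x n N wfN uN =
  subst (λ P → (lam x n xx · N) ▹β (P · P)) (subst-var-self x n N)
        (β-rule wf (uniform-joinable xx N (refl , refl) uN) (λ _ ()) (uniform-degree N uN))
  where
  xx : Term
  xx = var x n · var x n
  wf : WfTerm (lam x n xx · N)
  wf = wf-app (wf-lam (wf-app (wf-var x n) (wf-var x n) (uniform-joinable (var x n) (var x n) refl refl)) (here refl))
              wfN (uniform-joinable (lam x n xx) N (refl , refl) uN)

self-app-typing : ∀ x {U T} → Good (U ⇒ T) → Good U → dTy (U ⇒ T) ≡ dTy U →
                  let n = dTy U in lam x n (var x n · var x n) ∶⟨ ∅ ⊢₁ (U ⇒ T) ∧ U ⇒ T ⟩
self-app-typing x {U} {T} goodUT goodU deg =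
  ⇒I refl (conv (single-⊓ (x , dTy U) (U ⇒ T) U) ≈-refl
               (⇒E (ax goodUT deg) (ax goodU refl) single-joinable))

mainTheorem7 : (a b c : Atom) → a ≢ b → a ≢ c → b ≢ c →
    (y z x : Name) → y ≢ z → y ≢ x → z ≢ x →
    let Γ = single (y , 0) (atom b ⇒ ((atom a ⇒ atom c) ∧ atom a)) ⊓E single (z , 0) (atom b)
        yz = var y 0 · var z 0
        redex = lam x 0 (var x 0 · var x 0) · yz
    in (redex ▹β (yz · yz))
       × (redex ∶⟨ Γ ⊢₁ atom c ⟩)
       × ¬ ((yz · yz) ∶⟨ Γ ⊢₁ atom c ⟩)
mainTheorem7 a b c _ _ _ y z x _ _ _ =
  self-app-β x 0 yz wf-yz (refl , refl) , redex-typing , λ D → app-app-untypable D refl tame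
  where
  AC : Ty
  AC = atom a ⇒ atom c
  yz : Term
  yz = var y 0 · var z 0
  wf-yz : WfTerm yz
  wf-yz = wf-app (wf-var y 0) (wf-var z 0) (uniform-joinable (var y 0) (var z 0) refl refl)
  good-AC : Good AC
  good-AC = good-⇒ (good-atom a) (good-atom c) z≤
  good-y : Good (atom b ⇒ AC ∧ atom a)
  good-y = good-⇒ (good-atom b) (good-∧ good-AC (good-atom a) refl) z≤
  Γ : Env
  Γ = single (y , 0) (atom b ⇒ AC ∧ atom a) ⊓E single (z , 0) (atom b)
  redex-typing : (lam x 0 (var x 0 · var x 0) · yz) ∶⟨ Γ ⊢₁ atom c ⟩
  redex-typing = ⇒E (self-app-typing x good-AC (good-atom a) refl)
                    (⇒E (ax good-y refl) (ax (good-atom b) refl) single-joinable) ∅-joinable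
  -- y's type has codomain (a → c) ⊓ a with atomic part a; z's type is an atom.
  tame : TameEnv Γ
  tame = tame-⊓⁺ (EnvAll-single (inj₂ tt)) (EnvAll-single tt)
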